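{- Let $q=p^r$ be a prime power with $p\ge 5$. Then $\mathcal{S}_q=\{2,(q+1)/2\}$.
   Context: $\mathcal{T}_q$ is the set of functions $g:(\mathbb{Z}/q\mathbb{Z})^\times\to\{0,1\}$ such that $g(a)+g(-a)=1$ for all $a$, and $g(a)=0$ for every $a$ whose representative in $\{1,\dots,q-1\}$ is less than $q/3$. For $s\in(\mathbb{Z}/q\mathbb{Z})^\times$, $\theta_s$ denotes multiplication by $s$. $\mathcal{S}_q=\{s\in(\mathbb{Z}/q\mathbb{Z})^\times: s\ne 1\text{ and there exists } g\in\mathcal{T}_q \text{ with } g\circ\theta_s\in\mathcal{T}_q\}$. -}

module Defs where

open import Data.Nat using (ℕ; _+_; _*_; _∸_; _<_; _≤_; NonZero)
open import Data.Nat.DivMod using (_%_)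
open import Data.Nat.Coprimality using (Coprime)
open import Data.Bool using (Bool; true; false; not)
open import Data.Product using (Σ; _×_)
open import Relation.Binary.PropositionalEquality using (_≡_; _≢_)

-- Elements of (ℤ/qℤ)ˣ are represented by their canonical representatives
-- a ∈ {1,…,q-1} with gcd(a,q) = 1.
IsUnit : ℕ → ℕ → Set
IsUnit q a = 1 ≤ a × a < q × Coprime a q

neg : ℕ → ℕ → ℕ
neg q a = q ∸ a

θ : (q : ℕ) → .{{_ : NonZero q}} → ℕ → ℕ → ℕ
θ q s a = (s * a) % q

-- Functions are taken on ℕ (representatives); only their values
-- on units matter.  Values in {0,1} are encoded as Bool (false = 0, true = 1),
-- so g(a) + g(-a) = 1 reads g(-a) = not g(a).
-- "representative less than q/3" is 3a < q.
InT : ℕ → (ℕ → Bool) → Set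
InT q g = (∀ a → IsUnit q a → g (neg q a) ≡ not (g a))
        × (∀ a → IsUnit q a → 3 * a < q → g a ≡ false)

InS : (q : ℕ) → .{{_ : NonZero q}} → ℕ → Set
InS q s = IsUnit q s × s ≢ 1
        × Σ (ℕ → Bool) (λ g → InT q g × InT q (λ a → g (θ q s a)))

module Submission where

open import Defs
open import Data.Bool using (Bool; true; false; not)
open import Data.Empty using (⊥; ⊥-elim)
open import Data.Nat
open import Data.Nat.Coprimality using (Coprime; coprime-divisor)
open import Data.Nat.DivMod
open import Data.Nat.Divisibility
open import Data.Nat.Primality using (Prime; prime⇒irreducible; euclidsLemma)
open import Data.Nat.Properties
open import Data.List.Base using (_∷_; [])
open import Data.Nat.Tactic.RingSolver using (solve)
open import Data.Parity.Base as ℙ using (Parity; 0ℙ; 1ℙ)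
open import Data.Parity.Properties using (+-homo-+; *-homo-*)
open import Data.Product using (∃-syntax; _×_; _,_; proj₁; proj₂)
open import Data.Sum using (_⊎_; inj₁; inj₂; [_,_]′)
open import Function.Base using (_∘_; case_of_)
open import Function.Bundles using (_⇔_; mk⇔)
open import Relation.Binary.Definitions using (tri<; tri≈; tri>)
open import Relation.Binary.PropositionalEquality
open import Relation.Nullary using (¬_; yes; no)

-- Call a residue x small if 3x < q and large if 3x > 2q; since 3 ∤ q every residue is small, middle
-- or large, and x ↦ q − x swaps small with large. If g and g ∘ θₛ both lie in 𝒯_q, then θₛ sends no
-- small unit to a large one. For s ∉ {2, (q+1)/2} this fails. If 3s < q, follow the multiples s·k;
-- if 2s = q + t with t ≥ 3, follow s·(1 + 2j) ≡ s + jt. Either sequence climbs in steps below q/3,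
-- so it turns large while still below q and at a small index, and of two consecutive indices one is
-- prime to p. The other positions of s are refuted by a = 1 or a = 2. Conversely g = 1 on large,
-- the parity on middle and 0 on small residues works for s = 2, because doubling a small residue
-- gives an even one that is not large, and g ∘ θ₂ works for s = (q+1)/2 = 2⁻¹.

isOdd : Parity → Bool
isOdd 0ℙ = false
isOdd 1ℙ = true

parity≡0ℙ⇒2∣ : ∀ n → parity n ≡ 0ℙ → 2 ∣ n
parity≡0ℙ⇒2∣ zero          _    = 2 ∣0
parity≡0ℙ⇒2∣ (suc (suc n)) even = ∣m∣n⇒∣m+n ∣-refl (parity≡0ℙ⇒2∣ n even)

isOdd-complement : ∀ m n → parity (m + n) ≡ 1ℙ → isOdd (parity n) ≡ not (isOdd (parity m))
isOdd-complement m n odd with parity m | parity n | trans (sym (+-homo-+ m n)) odd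
... | 0ℙ | 1ℙ | _ = refl
... | 1ℙ | 0ℙ | _ = refl

isOdd-2* : ∀ k → isOdd (parity (2 * k)) ≡ false
isOdd-2* k = cong isOdd (*-homo-* 2 k)

m+n≡o+p∧o<m⇒n<p : ∀ {m n o p} → m + n ≡ o + p → o < m → n < p
m+n≡o+p∧o<m⇒n<p {m} {n} {o} {p} e o<m =
  +-cancelˡ-< o n p (subst (o + n <_) e (+-monoˡ-< n o<m))

crossing : (f : ℕ → ℕ) {b n : ℕ} → f 0 ≤ b → b < f n → ∃[ c ] f c ≤ b × b < f (suc c)
crossing f {n = zero}  f0≤b b<f0 = ⊥-elim (<⇒≱ b<f0 f0≤b)
crossing f {b} {suc n} f0≤b b<fn with f n ≤? b
... | yes fn≤b = n , fn≤b , b<fn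
... | no  fn≰b = crossing f f0≤b (≰⇒> fn≰b)

module _ {q : ℕ} .{{_ : NonZero q}} where

  %≡0∧<2q⇒≡q : ∀ w → w % q ≡ 0 → 0 < w → w < 2 * q → w ≡ q
  %≡0∧<2q⇒≡q w w%q≡0 0<w w<2q with m%n≡0⇒n∣m w q w%q≡0
  ... | divides zero          w≡0   = ⊥-elim (<⇒≢ 0<w (sym w≡0))
  ... | divides (suc zero)    w≡q   = trans w≡q (+-identityʳ q)
  ... | divides (suc (suc k)) w≡kq = ⊥-elim (<⇒≱ w<2q (begin
        2 * q             ≤⟨ m≤m+n (2 * q) (k * q) ⟩
        2 * q + k * q     ≡⟨ *-distribʳ-+ q 2 k ⟨
        (2 + k) * q       ≡⟨ w≡kq ⟨
        w                 ∎))
    where open ≤-Reasoning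

  θ[q∸a]+θa≡q : ∀ s a → a ≤ q → θ q s a ≢ 0 → θ q s (q ∸ a) + θ q s a ≡ q
  θ[q∸a]+θa≡q s a a≤q θa≢0 =
    %≡0∧<2q⇒≡q _ sum%q≡0 (≤-trans (n≢0⇒n>0 θa≢0) (m≤n+m _ _)) sum<2q
    where
    sum%q≡0 : (θ q s (q ∸ a) + θ q s a) % q ≡ 0
    sum%q≡0 = begin
      ((s * (q ∸ a)) % q + (s * a) % q) % q ≡⟨ %-distribˡ-+ (s * (q ∸ a)) (s * a) q ⟨
      (s * (q ∸ a) + s * a) % q             ≡⟨ cong (_% q) (*-distribˡ-+ s (q ∸ a) a) ⟨
      (s * (q ∸ a + a)) % q                 ≡⟨ cong (λ x → (s * x) % q) (m∸n+n≡m a≤q) ⟩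
      (s * q) % q                           ≡⟨ m*n%n≡0 s q ⟩
      0                                     ∎
      where open ≡-Reasoning
    sum<2q : θ q s (q ∸ a) + θ q s a < 2 * q
    sum<2q = subst (θ q s (q ∸ a) + θ q s a <_) (cong (q +_) (sym (+-identityʳ q)))
               (+-mono-< (m%n<n (s * (q ∸ a)) q) (m%n<n (s * a) q))

  θ∘θ≡θ* : ∀ s t a → θ q s (θ q t a) ≡ θ q (s * t) a
  θ∘θ≡θ* s t a = begin
    (s * ((t * a) % q)) % q             ≡⟨ %-distribˡ-* s ((t * a) % q) q ⟩
    ((s % q) * ((t * a) % q % q)) % q   ≡⟨ cong (λ x → ((s % q) * x) % q) (m%n%n≡m%n (t * a) q) ⟩
    ((s % q) * ((t * a) % q)) % q       ≡⟨ %-distribˡ-* s (t * a) q ⟨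
    (s * (t * a)) % q                   ≡⟨ cong (_% q) (*-assoc s t a) ⟨
    (s * t * a) % q                     ∎
    where open ≡-Reasoning

  θ[1+q]≡id : ∀ {a} → a < q → θ q (suc q) a ≡ a
  θ[1+q]≡id {a} a<q = begin
    (a + q * a) % q ≡⟨ cong (λ x → (a + x) % q) (*-comm q a) ⟩
    (a + a * q) % q ≡⟨ [m+kn]%n≡m%n a a q ⟩
    a % q           ≡⟨ m<n⇒m%n≡m a<q ⟩
    a               ∎
    where open ≡-Reasoning

p∣p^r : ∀ {p r} → 1 ≤ r → p ∣ p ^ r
p∣p^r {p} {suc r} _ = m∣m*n (p ^ r)

¬∣⇒coprime : ∀ {p a} → Prime p → ¬ p ∣ a → Coprime a p
¬∣⇒coprime p-prime p∤a (i∣a , i∣p) with prime⇒irreducible p-prime i∣p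
... | inj₁ i≡1 = i≡1
... | inj₂ refl = ⊥-elim (p∤a i∣a)

coprime-^ : ∀ {a p} r → Coprime a p → Coprime a (p ^ r)
coprime-^ zero    _     (_ , i∣1)      = ∣1⇒≡1 i∣1
coprime-^ (suc r) a⊥p {i} (i∣a , i∣p^r+1) = coprime-^ r a⊥p (i∣a , coprime-divisor i⊥p i∣p^r+1)
  where
  i⊥p : Coprime i _
  i⊥p (j∣i , j∣p) = a⊥p (∣-trans j∣i i∣a , j∣p)

module PrimePowerModulus
  (p q : ℕ) .{{_ : NonZero q}} (p-prime : Prime p) (5≤p : 5 ≤ p) (p∣q : p ∣ q)
  (coprime-q : ∀ {a} → ¬ p ∣ a → Coprime a q) where

  n<5⇒n<p : ∀ {n} → n < 5 → n < p
  n<5⇒n<p n<5 = <-≤-trans n<5 5≤p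

  5≤q : 5 ≤ q
  5≤q = ≤-trans 5≤p (∣⇒≤ p∣q)

  n<5⇒n<q : ∀ {n} → n < 5 → n < q
  n<5⇒n<q n<5 = <-≤-trans n<5 5≤q

  p∤1 : ¬ p ∣ 1
  p∤1 = >⇒∤ (n<5⇒n<p (s≤s (s≤s z≤n)))

  p∤2 : ¬ p ∣ 2
  p∤2 = >⇒∤ (n<5⇒n<p (s≤s (s≤s (s≤s z≤n))))

  2∤q : ¬ 2 ∣ q
  2∤q 2∣q = case coprime-q p∤2 (∣-refl , 2∣q) of λ ()

  3∤q : ¬ 3 ∣ q
  3∤q 3∣q = case coprime-q (>⇒∤ (n<5⇒n<p (s≤s (s≤s (s≤s (s≤s z≤n)))))) (∣-refl , 3∣q) of λ ()

  3∤2q : ¬ 3 ∣ 2 * q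
  3∤2q 3∣2q = 3∤q (∣m+n∣m⇒∣n (subst (3 ∣_) (+-comm q (2 * q)) (m∣m*n q)) 3∣2q)

  q-odd : parity q ≡ 1ℙ
  q-odd with parity q in q-even
  ... | 0ℙ = ⊥-elim (2∤q (parity≡0ℙ⇒2∣ q q-even))
  ... | 1ℙ = refl

  ¬p∣⇒unit : ∀ {a} → a < q → ¬ p ∣ a → IsUnit q a
  ¬p∣⇒unit {a} a<q p∤a = n≢0⇒n>0 a≢0 , a<q , coprime-q p∤a
    where
    a≢0 : a ≢ 0
    a≢0 a≡0 = p∤a (subst (p ∣_) (sym a≡0) (p ∣0))

  unit⇒¬p∣ : ∀ {a} → IsUnit q a → ¬ p ∣ a
  unit⇒¬p∣ (_ , _ , a⊥q) p∣a = p∤1 (subst (p ∣_) (a⊥q (p∣a , p∣q)) ∣-refl)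

  unit-neg : ∀ {a} → IsUnit q a → IsUnit q (q ∸ a)
  unit-neg {a} u@(0<a , a<q , _) = ¬p∣⇒unit (∸-monoʳ-< 0<a (<⇒≤ a<q)) p∤q∸a
    where
    p∤q∸a : ¬ p ∣ q ∸ a
    p∤q∸a p∣q∸a = unit⇒¬p∣ u (∣m+n∣m⇒∣n (subst (p ∣_) (sym (m∸n+n≡m (<⇒≤ a<q))) p∣q) p∣q∸a)

  unit-θ : ∀ {s a} → IsUnit q s → IsUnit q a → IsUnit q (θ q s a)
  unit-θ {s} {a} us ua = ¬p∣⇒unit (m%n<n (s * a) q) p∤sa%q
    where
    p∤sa%q : ¬ p ∣ (s * a) % q
    p∤sa%q p∣sa%q = [ unit⇒¬p∣ us , unit⇒¬p∣ ua ]′ (euclidsLemma s a p-prime (∣n∣m%n⇒∣m p∣q p∣sa%q))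

  ∈𝒯-resp : ∀ {f f′} → InT q f → (∀ a → IsUnit q a → f a ≡ f′ a) → InT q f′
  ∈𝒯-resp {f} {f′} (f-neg , f-small) f≗f′ =
    (λ a u → trans (sym (f≗f′ (q ∸ a) (unit-neg u))) (trans (f-neg a u) (cong not (f≗f′ a u)))) ,
    (λ a u small → trans (sym (f≗f′ a u)) (f-small a u small))

  Small Large : ℕ → Set
  Small x = 3 * x < q
  Large x = 2 * q < 3 * x

  q≤2q : q ≤ 2 * q
  q≤2q = m≤m+n q (q + 0)

  small⇒<q : ∀ {x} → Small x → x < q
  small⇒<q {x} = ≤-<-trans (m≤n*m x 3)

  small≤q⇒small : ∀ {x} → 3 * x ≤ q → Small x
  small≤q⇒small {x} le = ≤∧≢⇒< le (λ e → 3∤q (divides x (trans (sym e) (*-comm 3 x))))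

  data Position (x : ℕ) : Set where
    small  : Small x → Position x
    middle : q < 3 * x → 3 * x < 2 * q → Position x
    large  : Large x → Position x

  position : ∀ x → Position x
  position x with <-cmp (3 * x) q | <-cmp (3 * x) (2 * q)
  ... | tri< lt _ _ | _          = small lt
  ... | tri≈ _ e _  | _          = ⊥-elim (3∤q (divides x (trans (sym e) (*-comm 3 x))))
  ... | tri> _ _ gt | tri< lt _ _ = middle gt lt
  ... | tri> _ _ _  | tri≈ _ e _ = ⊥-elim (3∤2q (divides x (trans (sym e) (*-comm 3 x))))
  ... | tri> _ _ _  | tri> _ _ gt = large gt

  thrice-sum : ∀ {x y} → x + y ≡ q → 3 * x + 3 * y ≡ q + 2 * q
  thrice-sum {x} {y} e = trans (sym (*-distribˡ-+ 3 x y)) (cong (3 *_) e)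

  small⇒large-complement : ∀ {x y} → x + y ≡ q → Small x → Large y
  small⇒large-complement {x} {y} e = m+n≡o+p∧o<m⇒n<p (sym (thrice-sum {x} {y} e))

  large⇒small-complement : ∀ {x y} → x + y ≡ q → Large x → Small y
  large⇒small-complement {x} {y} e = m+n≡o+p∧o<m⇒n<p (trans (thrice-sum {x} {y} e) (+-comm q _))

  middle-complement : ∀ {x y} → x + y ≡ q → q < 3 * x → 3 * x < 2 * q → q < 3 * y × 3 * y < 2 * q
  middle-complement {x} {y} e q<3x 3x<2q =
    m+n≡o+p∧o<m⇒n<p (trans (+-comm _ q) (sym (thrice-sum {x} {y} e))) 3x<2q ,
    m+n≡o+p∧o<m⇒n<p (thrice-sum {x} {y} e) q<3x

  g : ℕ → Bool
  g x with position x
  ... | small _    = false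
  ... | middle _ _ = isOdd (parity x)
  ... | large _    = true

  g-small : ∀ {x} → Small x → g x ≡ false
  g-small {x} sx with position x
  ... | small _    = refl
  ... | middle gt _ = ⊥-elim (<-asym sx gt)
  ... | large gt   = ⊥-elim (<-asym sx (≤-<-trans q≤2q gt))

  g-middle : ∀ {x} → q < 3 * x → 3 * x < 2 * q → g x ≡ isOdd (parity x)
  g-middle {x} gt lt with position x
  ... | small sx    = ⊥-elim (<-asym sx gt)
  ... | middle _ _  = refl
  ... | large lx    = ⊥-elim (<-asym lt lx)

  g-large : ∀ {x} → Large x → g x ≡ true
  g-large {x} lx with position x
  ... | small sx   = ⊥-elim (<-asym sx (≤-<-trans q≤2q lx))
  ... | middle _ lt = ⊥-elim (<-asym lt lx)
  ... | large _    = refl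

  g-neg : ∀ {x y} → x + y ≡ q → g y ≡ not (g x)
  g-neg {x} {y} e with position x
  ... | small sx     = g-large {y} (small⇒large-complement {x} e sx)
  ... | large lx     = g-small {y} (large⇒small-complement {x} e lx)
  ... | middle gt lt = trans (g-middle {y} q<3y 3y<2q) (isOdd-complement x y (trans (cong parity e) q-odd))
    where
    q<3y = proj₁ (middle-complement {x} e gt lt)
    3y<2q = proj₂ (middle-complement {x} e gt lt)

  g-even : ∀ {k} → 3 * (2 * k) < 2 * q → g (2 * k) ≡ false
  g-even {k} lt with position (2 * k)
  ... | small _    = refl
  ... | middle _ _ = isOdd-2* k
  ... | large gt   = ⊥-elim (<-asym lt gt)

  g∈𝒯 : InT q g
  g∈𝒯 = (λ a u → g-neg {a} (m+[n∸m]≡n (<⇒≤ (proj₁ (proj₂ u))))) , (λ a _ → g-small {a})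

  unit-2 : IsUnit q 2
  unit-2 = ¬p∣⇒unit (n<5⇒n<q (s≤s (s≤s (s≤s z≤n)))) p∤2

  g∘θ₂∈𝒯 : InT q (λ a → g (θ q 2 a))
  g∘θ₂∈𝒯 = anti , small-case
    where
    anti : ∀ a → IsUnit q a → g (θ q 2 (q ∸ a)) ≡ not (g (θ q 2 a))
    anti a u@(_ , a<q , _) =
      g-neg {θ q 2 a} (trans (+-comm (θ q 2 a) _) (θ[q∸a]+θa≡q 2 a (<⇒≤ a<q) θ₂a≢0))
      where
      θ₂a≢0 : θ q 2 a ≢ 0
      θ₂a≢0 = m<n⇒n≢0 (proj₁ (unit-θ unit-2 u))
    small-case : ∀ a → IsUnit q a → Small a → g (θ q 2 a) ≡ false
    small-case a _ 3a<q = trans (cong g (m<n⇒m%n≡m 2a<q)) (g-even {a} 6a<2q)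
      where
      2a<q : 2 * a < q
      2a<q = ≤-<-trans (*-monoˡ-≤ a (n≤1+n 2)) 3a<q
      6a<2q : 3 * (2 * a) < 2 * q
      6a<2q = subst (_< 2 * q) (trans (sym (*-assoc 2 3 a)) (*-assoc 3 2 a)) (*-monoʳ-< 2 3a<q)

  2∈𝒮 : InS q 2
  2∈𝒮 = unit-2 , (λ ()) , g , g∈𝒯 , g∘θ₂∈𝒯

  m : ℕ
  m = (q + 1) / 2

  2m≡1+q : 2 * m ≡ 1 + q
  2m≡1+q = trans (m*[n/m]≡n 2∣q+1) (+-comm q 1)
    where
    2∣q+1 : 2 ∣ q + 1
    2∣q+1 = parity≡0ℙ⇒2∣ (q + 1) (trans (+-homo-+ q 1) (cong (ℙ._+ 1ℙ) q-odd))

  unit-m : IsUnit q m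
  unit-m = ¬p∣⇒unit m<q p∤m
    where
    m<q : m < q
    m<q = *-cancelˡ-< 2 m q (subst₂ _<_ (sym 2m≡1+q) (cong (q +_) (sym (+-identityʳ q)))
                                      (+-monoˡ-< q (n<5⇒n<q (s≤s (s≤s z≤n)))))
    p∤m : ¬ p ∣ m
    p∤m p∣m = p∤1 (∣m+n∣m⇒∣n (subst (p ∣_) (trans 2m≡1+q (+-comm 1 q)) (∣n⇒∣m*n 2 p∣m)) p∣q)

  m≢1 : m ≢ 1
  m≢1 m≡1 =
    <⇒≢ (n<5⇒n<q (s≤s (s≤s z≤n))) (sym (suc-injective (trans (sym 2m≡1+q) (cong (2 *_) m≡1))))

  θ₂∘θₘ≡id : ∀ {a} → a < q → θ q 2 (θ q m a) ≡ a
  θ₂∘θₘ≡id {a} a<q = trans (θ∘θ≡θ* 2 m a) (trans (cong (λ s → θ q s a) 2m≡1+q) (θ[1+q]≡id a<q))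

  m∈𝒮 : InS q m
  m∈𝒮 = unit-m , m≢1 , (λ a → g (θ q 2 a)) , g∘θ₂∈𝒯 ,
        ∈𝒯-resp g∈𝒯 (λ a u → cong g (sym (θ₂∘θₘ≡id (proj₁ (proj₂ u)))))

  Tame : ℕ → Set
  Tame s = ∀ a → IsUnit q a → Small a → ¬ Large (θ q s a)

  ∈𝒯⇒tame : ∀ {f s} → IsUnit q s → InT q f → InT q (λ a → f (θ q s a)) → Tame s
  ∈𝒯⇒tame {f} {s} us (f-neg , f-small) (_ , fθ-small) a ua sa lx =
    case trans (sym f[x]≡true) (fθ-small a ua sa) of λ ()
    where
    x = θ q s a
    x<q : x < q
    x<q = m%n<n (s * a) q
    y = q ∸ x
    uy : IsUnit q y
    uy = unit-neg (unit-θ us ua)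
    small-y : Small y
    small-y = large⇒small-complement {x} (m+[n∸m]≡n (<⇒≤ x<q)) lx
    f[x]≡true : f x ≡ true
    f[x]≡true = begin
      f x          ≡⟨ cong f (m∸[m∸n]≡n (<⇒≤ x<q)) ⟨
      f (q ∸ y)    ≡⟨ f-neg y uy ⟩
      not (f y)    ≡⟨ cong not (f-small y uy small-y) ⟩
      true         ∎
      where open ≡-Reasoning

  tame⇒¬large : ∀ {s a} → Tame s → ¬ p ∣ a → Small a → ¬ Large (θ q s a)
  tame⇒¬large {s} {a} tame p∤a sa = tame a (¬p∣⇒unit (small⇒<q {a} sa) p∤a) sa

  escape : ∀ {s a e} → Tame s → ¬ p ∣ e → Small a → Large (θ q s a)
         → (p ∣ a → Small (a + e) × Large (θ q s (a + e))) → ⊥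
  escape {s} {a} {e} tame p∤e sa la next with p ∣? a
  ... | no  p∤a = tame⇒¬large {s} {a} tame p∤a sa la
  ... | yes p∣a = tame⇒¬large {s} {a + e} tame (p∤e ∘ λ p∣a+e → ∣m+n∣m⇒∣n p∣a+e p∣a)
                    (proj₁ (next p∣a)) (proj₂ (next p∣a))

  q≤⇒large : ∀ {x} → q ≤ x → Large x
  q≤⇒large q≤x = <-≤-trans (m<n+m (2 * q) (n<5⇒n<q z<s)) (*-monoʳ-≤ 3 q≤x)

  ¬tame-large : ∀ {s} → s < q → Large s → ¬ Tame s
  ¬tame-large {s} s<q ls tame =
    tame⇒¬large {s} {1} tame p∤1 (n<5⇒n<q (s≤s (s≤s (s≤s (s≤s z≤n))))) (subst Large (sym θₛ1≡s) ls)
    where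
    θₛ1≡s : θ q s 1 ≡ s
    θₛ1≡s = trans (cong (_% q) (*-identityʳ s)) (m<n⇒m%n≡m s<q)

  ¬tame-middle : ∀ {s} → 3 ≤ s → q < 3 * s → 2 * s < q → ¬ Tame s
  ¬tame-middle {s} 3≤s q<3s 2s<q tame =
    tame⇒¬large {s} {2} tame p∤2 (≤-<-trans (*-monoʳ-≤ 2 3≤s) 2s<q) large-θₛ2
    where
    large-θₛ2 : Large (θ q s 2)
    large-θₛ2 = subst Large (sym (trans (cong (_% q) (*-comm s 2)) (m<n⇒m%n≡m 2s<q)))
                  (subst (2 * q <_) (trans (sym (*-assoc 2 3 s)) (*-assoc 3 2 s)) (*-monoʳ-< 2 q<3s))

  ¬tame-small : ∀ {s} → 3 ≤ s → Small s → ¬ Tame s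
  ¬tame-small {s} 3≤s 3s<q tame
    with crossing (λ k → 3 * (s * k)) {2 * q} {q}
           (≤-trans (≤-reflexive (cong (3 *_) (*-zeroʳ s))) z≤n)
           (q≤⇒large (m≤n*m q s {{>-nonZero (≤-trans (s≤s z≤n) 3≤s)}}))
  ... | c , below , above =
    escape {s} {suc c} {1} tame p∤1 (proj₁ fits-a) (subst Large (sym (proj₂ fits-a)) above) next
    where
    open ≤-Reasoning
    fits : ∀ {k} → 3 * (s * k) < 3 * q → Small k × θ q s k ≡ s * k
    fits {k} lt = ≤-<-trans (*-monoˡ-≤ k 3≤s) sk<q , m<n⇒m%n≡m sk<q
      where
      sk<q = *-cancelˡ-< 3 (s * k) q lt
    fits-a : Small (suc c) × θ q s (suc c) ≡ s * suc c
    fits-a = fits (begin-strict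
      3 * (s * suc c)       ≡⟨ cong (3 *_) (*-suc s c) ⟩
      3 * (s + s * c)       ≡⟨ *-distribˡ-+ 3 s (s * c) ⟩
      3 * s + 3 * (s * c)   <⟨ +-mono-<-≤ 3s<q below ⟩
      q + 2 * q             ∎)
    next : p ∣ suc c → Small (suc c + 1) × Large (θ q s (suc c + 1))
    next p∣a = proj₁ fits-a+1 ,
               subst Large (sym (proj₂ fits-a+1)) (<-≤-trans above (*-monoʳ-≤ 3 (*-monoʳ-≤ s (m≤m+n (suc c) 1))))
      where
      4≤c : 4 ≤ c
      4≤c = ≤-pred (≤-trans 5≤p (∣⇒≤ p∣a))
      small-2s : Small (2 * s)
      small-2s = small≤q⇒small {2 * s} (*-cancelˡ-≤ 2 (begin
        2 * (3 * (2 * s))   ≡⟨ solve (s ∷ []) ⟩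
        3 * (s * 4)         ≤⟨ *-monoʳ-≤ 3 (*-monoʳ-≤ s 4≤c) ⟩
        3 * (s * c)         ≤⟨ below ⟩
        2 * q               ∎))
      fits-a+1 = fits (begin-strict
        3 * (s * (suc c + 1))         ≡⟨ solve (s ∷ c ∷ []) ⟩
        3 * (s * c) + 3 * (2 * s)     <⟨ +-mono-≤-< below small-2s ⟩
        2 * q + q                     ≡⟨ +-comm (2 * q) q ⟩
        q + 2 * q                     ∎)

  θ-odd : ∀ {s t} j → q + t ≡ 2 * s → s + j * t < q → θ q s (1 + 2 * j) ≡ s + j * t
  θ-odd {s} {t} j q+t≡2s lt = begin
    (s * (1 + 2 * j)) % q     ≡⟨ cong (_% q) (solve (s ∷ j ∷ [])) ⟩
    (s + j * (2 * s)) % q     ≡⟨ cong (λ x → (s + j * x) % q) q+t≡2s ⟨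
    (s + j * (q + t)) % q     ≡⟨ cong (_% q) (solve (s ∷ j ∷ q ∷ t ∷ [])) ⟩
    (s + j * t + j * q) % q   ≡⟨ [m+kn]%n≡m%n (s + j * t) j q ⟩
    (s + j * t) % q           ≡⟨ m<n⇒m%n≡m lt ⟩
    s + j * t                 ∎
    where open ≡-Reasoning

  above-half-budget : ∀ {s t c} → q + t ≡ 2 * s → 3 * (s + c * t) ≤ 2 * q → 3 * t + 6 * (c * t) ≤ q
  above-half-budget {s} {t} {c} q+t≡2s below = +-cancelˡ-≤ (3 * q) _ _ (begin
    3 * q + (3 * t + 6 * (c * t))   ≡⟨ solve (q ∷ t ∷ c ∷ []) ⟩
    3 * (q + t) + 6 * (c * t)       ≡⟨ cong (λ x → 3 * x + 6 * (c * t)) q+t≡2s ⟩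
    3 * (2 * s) + 6 * (c * t)       ≡⟨ solve (s ∷ c ∷ t ∷ []) ⟩
    2 * (3 * (s + c * t))           ≤⟨ *-monoʳ-≤ 2 below ⟩
    2 * (2 * q)                     ≡⟨ solve (q ∷ []) ⟩
    3 * q + q                       ∎)
    where open ≤-Reasoning

  large-odd-multiple : ∀ {s t c} → q + t ≡ 2 * s → 3 * (s + c * t) ≤ 2 * q
                     → ∀ k → Small (k * t) → Large (s + (k + c) * t) → Large (θ q s (1 + 2 * (k + c)))
  large-odd-multiple {s} {t} {c} q+t≡2s below k small-kt = subst Large (sym (θ-odd (k + c) q+t≡2s v<q))
    where
    open ≤-Reasoning
    v<q : s + (k + c) * t < q
    v<q = *-cancelˡ-< 3 _ _ (begin-strict
      3 * (s + (k + c) * t)           ≡⟨ solve (s ∷ k ∷ c ∷ t ∷ []) ⟩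
      3 * (s + c * t) + 3 * (k * t)   <⟨ +-mono-≤-< below small-kt ⟩
      2 * q + q                       ≡⟨ +-comm (2 * q) q ⟩
      q + 2 * q                       ∎)

  ¬tame-above-half : ∀ {s t} → q + t ≡ 2 * s → 3 ≤ t → 3 * s < 2 * q → ¬ Tame s
  ¬tame-above-half {s} {t} q+t≡2s 3≤t 3s<2q tame
    with crossing (λ j → 3 * (s + j * t)) {2 * q} {q}
           (<⇒≤ (subst (λ x → 3 * x < 2 * q) (sym (+-identityʳ s)) 3s<2q))
           (q≤⇒large (≤-trans (m≤m*n q t {{>-nonZero (≤-trans (s≤s z≤n) 3≤t)}}) (m≤n+m (q * t) s)))
  ... | c , below , above =
    escape {s} {1 + 2 * suc c} {2} tame p∤2 small-a (large-at 1 small-t above) next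
    where
    open ≤-Reasoning
    budget : 3 * t + 6 * (c * t) ≤ q
    budget = above-half-budget {s} {t} {c} q+t≡2s below
    9+18c≤q : 9 + 18 * c ≤ q
    9+18c≤q = ≤-trans (+-mono-≤ (*-monoʳ-≤ 3 3≤t) (begin
      18 * c          ≡⟨ *-assoc 6 3 c ⟩
      6 * (3 * c)     ≤⟨ *-monoʳ-≤ 6 (*-monoˡ-≤ c 3≤t) ⟩
      6 * (t * c)     ≡⟨ cong (6 *_) (*-comm t c) ⟩
      6 * (c * t)     ∎)) budget
    small-t : Small (1 * t)
    small-t = small≤q⇒small {1 * t}
                (≤-trans (≤-reflexive (cong (3 *_) (*-identityˡ t))) (≤-trans (m≤m+n (3 * t) _) budget))
    large-at : ∀ k → Small (k * t) → Large (s + (k + c) * t) → Large (θ q s (1 + 2 * (k + c)))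
    large-at = large-odd-multiple {s} {t} {c} q+t≡2s below
    small-a : Small (1 + 2 * suc c)
    small-a = small≤q⇒small {1 + 2 * suc c} (begin
      3 * (1 + 2 * suc c)   ≡⟨ solve (c ∷ []) ⟩
      9 + 6 * c             ≤⟨ +-monoʳ-≤ 9 (*-monoˡ-≤ c {6} {18} (m≤m+n 6 12)) ⟩
      9 + 18 * c            ≤⟨ 9+18c≤q ⟩
      q                     ∎)
    next : p ∣ 1 + 2 * suc c → Small (1 + 2 * suc c + 2) × Large (θ q s (1 + 2 * suc c + 2))
    next p∣a = subst Small (sym a+2≡) small-a+2 ,
               subst (Large ∘ θ q s) (sym a+2≡)
                 (large-at 2 small-2t (<-≤-trans above (*-monoʳ-≤ 3 (+-monoʳ-≤ s (*-monoˡ-≤ t (n≤1+n (suc c)))))))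
      where
      a+2≡ : 1 + 2 * suc c + 2 ≡ 1 + 2 * (2 + c)
      a+2≡ = solve (c ∷ [])
      1≤c : 1 ≤ c
      1≤c = n≢0⇒n>0 λ c≡0 → <⇒≱ (n<5⇒n<p (s≤s (s≤s (s≤s (s≤s z≤n)))))
                                  (subst (λ x → p ≤ 1 + 2 * suc x) c≡0 (∣⇒≤ p∣a))
      small-2t : Small (2 * t)
      small-2t = small≤q⇒small {2 * t} (begin
        3 * (2 * t)             ≡⟨ *-assoc 3 2 t ⟨
        6 * t                   ≤⟨ *-monoʳ-≤ 6 (m≤n*m t c {{>-nonZero 1≤c}}) ⟩
        6 * (c * t)             ≤⟨ m≤n+m _ (3 * t) ⟩
        3 * t + 6 * (c * t)     ≤⟨ budget ⟩
        q                       ∎)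
      small-a+2 : Small (1 + 2 * (2 + c))
      small-a+2 = small≤q⇒small {1 + 2 * (2 + c)} (begin
        3 * (1 + 2 * (2 + c))   ≡⟨ solve (c ∷ []) ⟩
        9 + (6 + 6 * c)         ≤⟨ +-monoʳ-≤ 9 (+-monoˡ-≤ (6 * c) (*-monoʳ-≤ 6 1≤c)) ⟩
        9 + (6 * c + 6 * c)     ≤⟨ +-monoʳ-≤ 9 (+-monoʳ-≤ (6 * c) (*-monoˡ-≤ c {6} {12} (m≤m+n 6 6))) ⟩
        9 + (6 * c + 12 * c)    ≡⟨ solve (c ∷ []) ⟩
        9 + 18 * c              ≤⟨ 9+18c≤q ⟩
        q                       ∎)

  tame∧3≤s⇒2s≡1+q : ∀ {s} → 3 ≤ s → s < q → Tame s → 2 * s ≡ 1 + q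
  tame∧3≤s⇒2s≡1+q {s} 3≤s s<q tame with position s
  ... | small small-s = ⊥-elim (¬tame-small 3≤s small-s tame)
  ... | large large-s = ⊥-elim (¬tame-large s<q large-s tame)
  ... | middle q<3s 3s<2q with <-cmp (2 * s) q
  ...   | tri< 2s<q _ _ = ⊥-elim (¬tame-middle 3≤s q<3s 2s<q tame)
  ...   | tri≈ _ 2s≡q _ = ⊥-elim (2∤q (divides s (trans (sym 2s≡q) (*-comm 2 s))))
  ...   | tri> _ _ q<2s = above-half (2 * s ∸ q) (m+[n∸m]≡n (<⇒≤ q<2s))
    where
    2∤t : ∀ {t} → q + t ≡ 2 * s → ¬ 2 ∣ t
    2∤t {t} q+t≡2s 2∣t = 2∤q (∣m+n∣m⇒∣n (subst (2 ∣_) (+-comm q t) 2∣q+t) 2∣t)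
      where
      2∣q+t : 2 ∣ q + t
      2∣q+t = divides s (trans q+t≡2s (*-comm 2 s))
    above-half : ∀ t → q + t ≡ 2 * s → 2 * s ≡ 1 + q
    above-half 0                   q+0≡2s = ⊥-elim (2∤t q+0≡2s (2 ∣0))
    above-half 1                   q+1≡2s = trans (sym q+1≡2s) (+-comm q 1)
    above-half 2                   q+2≡2s = ⊥-elim (2∤t q+2≡2s ∣-refl)
    above-half (suc (suc (suc t))) q+t≡2s =
      ⊥-elim (¬tame-above-half {s} q+t≡2s (s≤s (s≤s (s≤s z≤n))) 3s<2q tame)

  InS⇒2∨m : ∀ s → InS q s → s ≡ 2 ⊎ s ≡ m
  InS⇒2∨m s (us@(1≤s , s<q , _) , s≢1 , f , f∈𝒯 , f∘θₛ∈𝒯) with s ≟ 2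
  ... | yes s≡2 = inj₁ s≡2
  ... | no  s≢2 = inj₂ (*-cancelˡ-≡ s m 2 (trans 2s≡1+q (sym 2m≡1+q)))
    where
    3≤s : 3 ≤ s
    3≤s = ≤∧≢⇒< (≤∧≢⇒< 1≤s (s≢1 ∘ sym)) (s≢2 ∘ sym)
    2s≡1+q : 2 * s ≡ 1 + q
    2s≡1+q = tame∧3≤s⇒2s≡1+q 3≤s s<q (∈𝒯⇒tame us f∈𝒯 f∘θₛ∈𝒯)

  2∨m⇒InS : ∀ s → s ≡ 2 ⊎ s ≡ m → InS q s
  2∨m⇒InS s (inj₁ refl) = 2∈𝒮
  2∨m⇒InS s (inj₂ refl) = m∈𝒮

lemma5p6 : (p r q : ℕ) → Prime p → 5 ≤ p → 1 ≤ r → q ≡ p ^ r → .{{_ : NonZero q}}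
           → (s : ℕ) → InS q s ⇔ (s ≡ 2 ⊎ s ≡ (q + 1) / 2)
lemma5p6 p r q p-prime 5≤p 1≤r refl s = mk⇔ (InS⇒2∨m s) (2∨m⇒InS s)
  where
  open PrimePowerModulus p (p ^ r) p-prime 5≤p (p∣p^r 1≤r) (coprime-^ r ∘ ¬∣⇒coprime p-prime)
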